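{- Let $L$ be an integral lattice, $V=\mathbb Q\otimes L$, and let $t,f\in O(L)$ commute, where $t$ is an involution and $f$ satisfies $f^2=-1$. For $\varepsilon\in\{+,-\}$ let $V^\varepsilon(t)$ be the $\varepsilon 1$-eigenspace of $t$ on $V$, $L^\varepsilon(t)=L\cap V^\varepsilon(t)$, $P^\varepsilon$ the orthogonal projection of $V$ onto $V^\varepsilon(t)$, and $$MC(L,t,f,\varepsilon)=L^\varepsilon(t)+P^\varepsilon(L)(f-1).$$ Then (i) $MC(L,t,f,\varepsilon)$ is an integral lattice; (ii) if $L^\varepsilon(t)$ is doubly even (all norms divisible by $4$), then $MC(L,t,f,\varepsilon)$ is an even lattice.
   Context: Lattices are finite rank free abelian groups with a positive definite rational-valued symmetric bilinear form; linear maps act on the right. -}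

module Defs where

open import Data.Nat using (ℕ; zero; suc)
open import Data.Fin using (Fin; zero; suc; _≟_)
open import Data.Integer using (ℤ; +_)
import Data.Integer as ℤ
open import Data.Rational using (ℚ; _+_; _*_; _-_; -_; 0ℚ; 1ℚ; _<_; _/_)
open import Data.Sign using (Sign)
open import Data.Product using (Σ; ∃; _×_; _,_)
open import Relation.Binary.PropositionalEquality using (_≡_)
open import Relation.Nullary using (¬_; yes; no)

-- Convention: a lattice L of rank n is identified with ℤⁿ via a basis;
-- its form is given by the (rational, symmetric, positive definite)
-- Gram matrix G.  V = ℚ ⊗ L = ℚⁿ, and L ⊂ V is the set of integral vectors.

ι : ℤ → ℚ
ι z = z / 1

IsInt : ℚ → Set
IsInt q = ∃ λ (z : ℤ) → q ≡ ι z

Σ[_]_ : (n : ℕ) → (Fin n → ℚ) → ℚ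
Σ[ zero ] g = 0ℚ
Σ[ suc n ] g = g zero + Σ[ n ] (λ i → g (suc i))

Vec : ℕ → Set
Vec n = Fin n → ℚ

Mat : ℕ → Set
Mat n = Fin n → Fin n → ℚ

_≈ᵥ_ : ∀ {n} → Vec n → Vec n → Set
x ≈ᵥ y = ∀ i → x i ≡ y i

_≈ₘ_ : ∀ {n} → Mat n → Mat n → Set
A ≈ₘ B = ∀ i j → A i j ≡ B i j

0ᵥ : ∀ {n} → Vec n
0ᵥ _ = 0ℚ

_+ᵥ_ : ∀ {n} → Vec n → Vec n → Vec n
(x +ᵥ y) i = x i + y i

_-ᵥ_ : ∀ {n} → Vec n → Vec n → Vec n
(x -ᵥ y) i = x i - y i

B : ∀ {n} → Mat n → Vec n → Vec n → ℚ
B {n} G x y = Σ[ n ] (λ i → Σ[ n ] (λ j → x i * G i j * y j))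

-- linear maps act on the right: (x A)_j = Σ_i x_i A_ij
_·_ : ∀ {n} → Vec n → Mat n → Vec n
_·_ {n} x A j = Σ[ n ] (λ i → x i * A i j)

-- matrix product, so that x · (A ∘ₘ C) = (x · A) · C
_∘ₘ_ : ∀ {n} → Mat n → Mat n → Mat n
_∘ₘ_ {n} A C i k = Σ[ n ] (λ j → A i j * C j k)

Iₘ : ∀ {n} → Mat n
Iₘ i j with i ≟ j
... | yes _ = 1ℚ
... | no _ = 0ℚ

-ₘ_ : ∀ {n} → Mat n → Mat n
(-ₘ A) i j = - (A i j)

InL : ∀ {n} → Vec n → Set
InL x = ∀ i → IsInt (x i)

IntMat : ∀ {n} → Mat n → Set
IntMat A = ∀ i j → IsInt (A i j)

IsLattice : ∀ {n} → Mat n → Set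
IsLattice {n} G =
  (∀ i j → G i j ≡ G j i) ×
  (∀ (x : Vec n) → InL x → ¬ (x ≈ᵥ 0ᵥ) → 0ℚ < B G x x)

IsIntegral : ∀ {n} → Mat n → Set
IsIntegral {n} G = ∀ (x y : Vec n) → InL x → InL y → IsInt (B G x y)

InO : ∀ {n} → Mat n → Mat n → Set
InO {n} G A =
  IntMat A ×
  (∃ λ (A' : Mat n) → IntMat A' × (A ∘ₘ A') ≈ₘ Iₘ × (A' ∘ₘ A) ≈ₘ Iₘ) ×
  (∀ (x y : Vec n) → InL x → InL y → B G (x · A) (y · A) ≡ B G x y)

⟦_⟧ : Sign → ℚ
⟦ Sign.+ ⟧ = 1ℚ
⟦ Sign.- ⟧ = - 1ℚ

InVε : ∀ {n} → Mat n → Sign → Vec n → Set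
InVε t ε v = (v · t) ≈ᵥ (λ i → ⟦ ε ⟧ * v i)

InLε : ∀ {n} → Mat n → Sign → Vec n → Set
InLε t ε v = InL v × InVε t ε v

IsProjε : ∀ {n} → Mat n → Mat n → Sign → Vec n → Vec n → Set
IsProjε {n} G t ε v p =
  InVε t ε p × (∀ (w : Vec n) → InVε t ε w → B G (v -ᵥ p) w ≡ 0ℚ)

-- MC(L,t,f,ε) = L^ε(t) + P^ε(L)(f-1), as a subset of V:
-- x = a + (p f - p) with a ∈ L^ε(t), p = P^ε(b), b ∈ L.
InMC : ∀ {n} → Mat n → Mat n → Mat n → Sign → Vec n → Set
InMC {n} G t f ε x =
  ∃ λ (a : Vec n) → ∃ λ (b : Vec n) → ∃ λ (p : Vec n) →
    InLε t ε a × InL b × IsProjε G t ε b p ×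
    x ≈ᵥ (a +ᵥ ((p · f) -ᵥ p))

DoublyEvenQ : ℚ → Set
DoublyEvenQ q = ∃ λ (z : ℤ) → q ≡ ι (+ 4 ℤ.* z)

EvenQ : ℚ → Set
EvenQ q = ∃ λ (z : ℤ) → q ≡ ι (+ 2 ℤ.* z)

{-# OPTIONS --safe #-}

-- Write x ∈ MC as a + p(f − 1) with a ∈ L^ε(t) and p = P^ε(b), b ∈ L. An isometry f with
-- f² = −1 is skew-adjoint, so B(p(f − 1), y) = −B(p, y(f + 1)); since f commutes with t,
-- y(f + 1) lies in V^ε(t), where P^ε can be dropped: B(p, w) = B(b, w). Doing this in both
-- arguments and using (f − 1)(f + 1) = −2 and 2P^ε(b') = b' + ε b't ∈ L gives
--   B(x, y) = B(a', a) − B(b', a(f + 1)) − B(b, a'(f + 1)) + B(b, b' + ε b't),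
-- a sum of integers. For y = x the two middle terms coincide, and B(b, b + ε bt) is half the
-- norm of b + ε bt ∈ L^ε(t), so it is even once L^ε(t) is doubly even.
-- The isometry condition defining O(L) only concerns L; it extends to V by bilinearity.

module Submission where

open import Defs
open import Data.Nat using (ℕ; zero; suc)
open import Data.Fin using (Fin; zero; suc; _≟_)
import Data.Integer as ℤ
import Data.Integer.Properties as ℤP
import Data.Integer.Tactic.RingSolver as ℤ-Solver
open import Data.Rational using (ℚ; _+_; _*_; _-_; -_; 0ℚ; 1ℚ; toℚᵘ)
import Data.Rational as ℚ
open import Data.Rational.Properties
  using ( +-*-ring; +-*-commutativeRing; +-0-group; toℚᵘ-injective; toℚᵘ-fromℚᵘ
        ; toℚᵘ-homo-+; toℚᵘ-homo-*; toℚᵘ-homo‿-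
        ; neg-distrib-+; *-assoc; *-distribˡ-+; *-distribʳ-+; *-identityˡ; *-identityʳ; *-zeroʳ; +-identityˡ; +-identityʳ)
import Data.Rational.Properties as ℚP
open import Data.Fin.Properties using (suc-injective)
open import Function using (_∘_)
import Data.Rational.Unnormalised as ℚᵘ
import Data.Rational.Unnormalised.Properties as ℚᵘP
open import Data.Sign using (Sign)
open import Data.Product using (_×_; _,_; proj₁)
open import Algebra.Bundles using (Ring)
open import Algebra.Properties.Group +-0-group using (x∙y⁻¹≈ε⇒x≈y)
open import Algebra.Properties.Ring +-*-ring using (-1*x≈-x)
open import Algebra.Properties.Semiring.Sum (Ring.semiring +-*-ring)
  using (sum; sum-cong-≗; sum-replicate-zero; ∑-distrib-+; ∑-comm; *-distribˡ-sum; *-distribʳ-sum)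
open import Relation.Binary.PropositionalEquality
open import Relation.Nullary using (¬_; yes; no)
open import Relation.Nullary.Decidable using (dec⇒maybe)
open import Data.Empty using (⊥-elim)
open import Level using (0ℓ)
open import Tactic.RingSolver using (solve-∀)
open import Tactic.RingSolver.Core.AlmostCommutativeRing
  using (AlmostCommutativeRing; fromCommutativeRing)

ℚ-ring : AlmostCommutativeRing 0ℓ 0ℓ
ℚ-ring = fromCommutativeRing +-*-commutativeRing (λ q → dec⇒maybe (0ℚ ℚP.≟ q))

toℚᵘ-ι : ∀ z → toℚᵘ (ι z) ℚᵘ.≃ ℚᵘ.mkℚᵘ z 0
toℚᵘ-ι z = toℚᵘ-fromℚᵘ (ℚᵘ.mkℚᵘ z 0)

ι-homo-+ : ∀ a b → ι (a ℤ.+ b) ≡ ι a + ι b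
ι-homo-+ a b = toℚᵘ-injective (begin
  toℚᵘ (ι (a ℤ.+ b))            ≈⟨ toℚᵘ-ι (a ℤ.+ b) ⟩
  ℚᵘ.mkℚᵘ (a ℤ.+ b) 0           ≈⟨ ℚᵘ.*≡* (cong (ℤ._* ℤ.+ 1) (cong₂ ℤ._+_ (sym (ℤP.*-identityʳ a)) (sym (ℤP.*-identityʳ b)))) ⟩
  ℚᵘ.mkℚᵘ a 0 ℚᵘ.+ ℚᵘ.mkℚᵘ b 0  ≈⟨ ℚᵘP.+-cong (toℚᵘ-ι a) (toℚᵘ-ι b) ⟨
  toℚᵘ (ι a) ℚᵘ.+ toℚᵘ (ι b)    ≈⟨ toℚᵘ-homo-+ (ι a) (ι b) ⟨
  toℚᵘ (ι a + ι b)              ∎)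
  where open ℚᵘP.≃-Reasoning

ι-homo-* : ∀ a b → ι (a ℤ.* b) ≡ ι a * ι b
ι-homo-* a b = toℚᵘ-injective (begin
  toℚᵘ (ι (a ℤ.* b))            ≈⟨ toℚᵘ-ι (a ℤ.* b) ⟩
  ℚᵘ.mkℚᵘ (a ℤ.* b) 0           ≈⟨ ℚᵘP.*-cong (toℚᵘ-ι a) (toℚᵘ-ι b) ⟨
  toℚᵘ (ι a) ℚᵘ.* toℚᵘ (ι b)    ≈⟨ toℚᵘ-homo-* (ι a) (ι b) ⟨
  toℚᵘ (ι a * ι b)              ∎)
  where open ℚᵘP.≃-Reasoning

ι-homo‿- : ∀ a → ι (ℤ.- a) ≡ - ι a
ι-homo‿- a = toℚᵘ-injective (begin
  toℚᵘ (ι (ℤ.- a))    ≈⟨ toℚᵘ-ι (ℤ.- a) ⟩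
  ℚᵘ.mkℚᵘ (ℤ.- a) 0   ≈⟨ ℚᵘP.-‿cong (toℚᵘ-ι a) ⟨
  ℚᵘ.- toℚᵘ (ι a)     ≈⟨ toℚᵘ-homo‿- (ι a) ⟨
  toℚᵘ (- ι a)        ∎)
  where open ℚᵘP.≃-Reasoning

IsInt-+ : ∀ {p q} → IsInt p → IsInt q → IsInt (p + q)
IsInt-+ (a , refl) (b , refl) = a ℤ.+ b , sym (ι-homo-+ a b)

IsInt-* : ∀ {p q} → IsInt p → IsInt q → IsInt (p * q)
IsInt-* (a , refl) (b , refl) = a ℤ.* b , sym (ι-homo-* a b)

IsInt-neg : ∀ {p} → IsInt p → IsInt (- p)
IsInt-neg (a , refl) = ℤ.- a , sym (ι-homo‿- a)

EvenQ-+ : ∀ {p q} → EvenQ p → EvenQ q → EvenQ (p + q)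
EvenQ-+ (a , refl) (b , refl) =
  a ℤ.+ b , trans (sym (ι-homo-+ (ℤ.+ 2 ℤ.* a) (ℤ.+ 2 ℤ.* b))) (cong ι (sym (ℤP.*-distribˡ-+ (ℤ.+ 2) a b)))

EvenQ-neg : ∀ {p} → EvenQ p → EvenQ (- p)
EvenQ-neg (a , refl) =
  ℤ.- a , trans (sym (ι-homo‿- (ℤ.+ 2 ℤ.* a))) (cong ι (ℤP.neg-distribʳ-* (ℤ.+ 2) a))

EvenQ-double : ∀ {p} → IsInt p → EvenQ (p + p)
EvenQ-double (a , refl) = a , trans (sym (ι-homo-+ a a)) (cong ι (double≡2* a))
  where
  double≡2* : ∀ a → a ℤ.+ a ≡ ℤ.+ 2 ℤ.* a
  double≡2* = ℤ-Solver.solve-∀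

DoublyEvenQ⇒EvenQ : ∀ {p} → DoublyEvenQ p → EvenQ p
DoublyEvenQ⇒EvenQ (a , refl) = ℤ.+ 2 ℤ.* a , cong ι (ℤP.*-assoc (ℤ.+ 2) (ℤ.+ 2) a)

double-injective : ∀ {p q} → p + p ≡ q + q → p ≡ q
double-injective {p} {q} p+p≡q+q = begin
  p            ≡⟨ half-double p ⟨
  ½ * (p + p)  ≡⟨ cong (½ *_) p+p≡q+q ⟩
  ½ * (q + q)  ≡⟨ half-double q ⟩
  q            ∎
  where
  open ≡-Reasoning
  ½ : ℚ
  ½ = ℤ.+ 1 ℚ./ 2
  half-double : ∀ q → ½ * (q + q) ≡ q
  half-double q = begin
    ½ * (q + q)      ≡⟨ *-distribˡ-+ ½ q q ⟩
    ½ * q + ½ * q    ≡⟨ *-distribʳ-+ q ½ ½ ⟨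
    (½ + ½) * q      ≡⟨ *-identityˡ q ⟩
    q                ∎

EvenQ-halve : ∀ {p} → DoublyEvenQ (p + p) → EvenQ p
EvenQ-halve {p} (a , p+p≡4a) = a , double-injective (begin
  p + p                                    ≡⟨ p+p≡4a ⟩
  ι (ℤ.+ 4 ℤ.* a)                          ≡⟨ cong ι (4*≡2*+2* a) ⟩
  ι (ℤ.+ 2 ℤ.* a ℤ.+ ℤ.+ 2 ℤ.* a)          ≡⟨ ι-homo-+ (ℤ.+ 2 ℤ.* a) (ℤ.+ 2 ℤ.* a) ⟩
  ι (ℤ.+ 2 ℤ.* a) + ι (ℤ.+ 2 ℤ.* a)        ∎)
  where
  open ≡-Reasoning
  4*≡2*+2* : ∀ a → ℤ.+ 4 ℤ.* a ≡ ℤ.+ 2 ℤ.* a ℤ.+ ℤ.+ 2 ℤ.* a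
  4*≡2*+2* = ℤ-Solver.solve-∀

Σ≡sum : ∀ n (g : Fin n → ℚ) → Σ[ n ] g ≡ sum g
Σ≡sum zero    g = refl
Σ≡sum (suc n) g = cong (g zero +_) (Σ≡sum n (λ i → g (suc i)))

Σ-cong : ∀ n {g h : Fin n → ℚ} → (∀ i → g i ≡ h i) → Σ[ n ] g ≡ Σ[ n ] h
Σ-cong n {g} {h} g≗h = trans (Σ≡sum n g) (trans (sum-cong-≗ g≗h) (sym (Σ≡sum n h)))

Σ-distrib-+ : ∀ n (g h : Fin n → ℚ) → Σ[ n ] (λ i → g i + h i) ≡ Σ[ n ] g + Σ[ n ] h
Σ-distrib-+ n g h = trans (Σ≡sum n _)
  (trans (∑-distrib-+ g h) (sym (cong₂ _+_ (Σ≡sum n g) (Σ≡sum n h))))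

*-distribˡ-Σ : ∀ n c (g : Fin n → ℚ) → c * Σ[ n ] g ≡ Σ[ n ] (λ i → c * g i)
*-distribˡ-Σ n c g = trans (cong (c *_) (Σ≡sum n g))
  (trans (*-distribˡ-sum c g) (sym (Σ≡sum n _)))

*-distribʳ-Σ : ∀ n c (g : Fin n → ℚ) → Σ[ n ] g * c ≡ Σ[ n ] (λ i → g i * c)
*-distribʳ-Σ n c g = trans (cong (_* c) (Σ≡sum n g))
  (trans (*-distribʳ-sum c g) (sym (Σ≡sum n _)))

Σ-comm : ∀ m n (g : Fin m → Fin n → ℚ) →
         Σ[ m ] (λ i → Σ[ n ] (g i)) ≡ Σ[ n ] (λ j → Σ[ m ] (λ i → g i j))
Σ-comm m n g = begin
  Σ[ m ] (λ i → Σ[ n ] (g i))              ≡⟨ Σ-cong m (λ i → Σ≡sum n (g i)) ⟩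
  Σ[ m ] (λ i → sum (g i))                 ≡⟨ Σ≡sum m _ ⟩
  sum (λ i → sum (g i))                    ≡⟨ ∑-comm g ⟩
  sum (λ j → sum (λ i → g i j))            ≡⟨ Σ≡sum n _ ⟨
  Σ[ n ] (λ j → sum (λ i → g i j))         ≡⟨ Σ-cong n (λ j → Σ≡sum m (λ i → g i j)) ⟨
  Σ[ n ] (λ j → Σ[ m ] (λ i → g i j))      ∎
  where open ≡-Reasoning

Σ-zero : ∀ n → Σ[ n ] (λ _ → 0ℚ) ≡ 0ℚ
Σ-zero n = trans (Σ≡sum n _) (sum-replicate-zero n)

neg-Σ : ∀ n (g : Fin n → ℚ) → - Σ[ n ] g ≡ Σ[ n ] (λ i → - g i)
neg-Σ n g = trans (sym (-1*x≈-x _)) (trans (*-distribˡ-Σ n (- 1ℚ) g) (Σ-cong n (λ i → -1*x≈-x (g i))))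

Σ-distrib-− : ∀ n (g h : Fin n → ℚ) → Σ[ n ] (λ i → g i - h i) ≡ Σ[ n ] g - Σ[ n ] h
Σ-distrib-− n g h = trans (Σ-distrib-+ n g (λ i → - h i)) (cong (Σ[ n ] g +_) (sym (neg-Σ n h)))

Σ-single : ∀ n (g : Fin n → ℚ) j → (∀ i → ¬ i ≡ j → g i ≡ 0ℚ) → Σ[ n ] g ≡ g j
Σ-single (suc n) g zero vanish = begin
  g zero + Σ[ n ] (g ∘ suc)   ≡⟨ cong (g zero +_) (trans (Σ-cong n (λ i → vanish (suc i) λ ())) (Σ-zero n)) ⟩
  g zero + 0ℚ                   ≡⟨ +-identityʳ (g zero) ⟩
  g zero                      ∎
  where open ≡-Reasoning
Σ-single (suc n) g (suc j) vanish = begin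
  g zero + Σ[ n ] (g ∘ suc)   ≡⟨ cong₂ _+_ (vanish zero λ ()) (Σ-single n (g ∘ suc) j (λ i i≢j → vanish (suc i) (i≢j ∘ suc-injective))) ⟩
  0ℚ + g (suc j)              ≡⟨ +-identityˡ (g (suc j)) ⟩
  g (suc j)                   ∎
  where open ≡-Reasoning

Σ-*-Σ : ∀ m n (a : Fin m → ℚ) c (b : Fin n → ℚ) →
        Σ[ m ] a * c * Σ[ n ] b ≡ Σ[ m ] (λ i → Σ[ n ] (λ j → a i * c * b j))
Σ-*-Σ m n a c b = begin
  Σ[ m ] a * c * Σ[ n ] b                        ≡⟨ cong (_* Σ[ n ] b) (*-distribʳ-Σ m c a) ⟩
  Σ[ m ] (λ i → a i * c) * Σ[ n ] b              ≡⟨ *-distribʳ-Σ m (Σ[ n ] b) _ ⟩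
  Σ[ m ] (λ i → a i * c * Σ[ n ] b)              ≡⟨ Σ-cong m (λ i → *-distribˡ-Σ n (a i * c) b) ⟩
  Σ[ m ] (λ i → Σ[ n ] (λ j → a i * c * b j))    ∎
  where open ≡-Reasoning

*-Σ-* : ∀ n c (g : Fin n → ℚ) d → c * Σ[ n ] g * d ≡ Σ[ n ] (λ i → c * g i * d)
*-Σ-* n c g d = trans (cong (_* d) (*-distribˡ-Σ n c g)) (*-distribʳ-Σ n d _)

ΣΣ-comm : ∀ m n (g : Fin m → Fin m → Fin n → Fin n → ℚ) →
          Σ[ m ] (λ k → Σ[ m ] (λ l → Σ[ n ] (λ i → Σ[ n ] (λ j → g k l i j)))) ≡
          Σ[ n ] (λ i → Σ[ n ] (λ j → Σ[ m ] (λ k → Σ[ m ] (λ l → g k l i j))))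
ΣΣ-comm m n g = begin
  Σ[ m ] (λ k → Σ[ m ] (λ l → Σ[ n ] (λ i → Σ[ n ] (λ j → g k l i j))))
    ≡⟨ Σ-cong m (λ k → Σ-comm m n _) ⟩
  Σ[ m ] (λ k → Σ[ n ] (λ i → Σ[ m ] (λ l → Σ[ n ] (λ j → g k l i j))))
    ≡⟨ Σ-comm m n _ ⟩
  Σ[ n ] (λ i → Σ[ m ] (λ k → Σ[ m ] (λ l → Σ[ n ] (λ j → g k l i j))))
    ≡⟨ Σ-cong n (λ i → Σ-cong m (λ k → Σ-comm m n _)) ⟩
  Σ[ n ] (λ i → Σ[ m ] (λ k → Σ[ n ] (λ j → Σ[ m ] (λ l → g k l i j))))
    ≡⟨ Σ-cong n (λ i → Σ-comm m n _) ⟩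
  Σ[ n ] (λ i → Σ[ n ] (λ j → Σ[ m ] (λ k → Σ[ m ] (λ l → g k l i j))))
    ∎
  where open ≡-Reasoning

IsInt-Σ : ∀ n (g : Fin n → ℚ) → (∀ i → IsInt (g i)) → IsInt (Σ[ n ] g)
IsInt-Σ zero    g g-int = ℤ.+ 0 , refl
IsInt-Σ (suc n) g g-int = IsInt-+ (g-int zero) (IsInt-Σ n (g ∘ suc) (g-int ∘ suc))

infixr 7 _⊛_

_⊛_ : ∀ {n} → ℚ → Vec n → Vec n
(c ⊛ x) i = c * x i

module _ {n : ℕ} where

  ·-cong : ∀ {x y : Vec n} (A : Mat n) → x ≈ᵥ y → (x · A) ≈ᵥ (y · A)
  ·-cong A x≈y j = Σ-cong n (λ i → cong (_* A i j) (x≈y i))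

  ·-congʳ : ∀ (x : Vec n) {A C : Mat n} → A ≈ₘ C → (x · A) ≈ᵥ (x · C)
  ·-congʳ x A≈C j = Σ-cong n (λ i → cong (x i *_) (A≈C i j))

  ·-distrib-+ᵥ : ∀ (x y : Vec n) A → ((x +ᵥ y) · A) ≈ᵥ ((x · A) +ᵥ (y · A))
  ·-distrib-+ᵥ x y A j =
    trans (Σ-cong n (λ i → *-distribʳ-+ (A i j) (x i) (y i))) (Σ-distrib-+ n _ _)

  ·-distrib-−ᵥ : ∀ (x y : Vec n) A → ((x -ᵥ y) · A) ≈ᵥ ((x · A) -ᵥ (y · A))
  ·-distrib-−ᵥ x y A j =
    trans (Σ-cong n (λ i → distrib-− (x i) (y i) (A i j))) (Σ-distrib-− n _ _)
    where
    distrib-− : ∀ a b c → (a - b) * c ≡ a * c - b * c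
    distrib-− = solve-∀ ℚ-ring

  ·-⊛ : ∀ c (x : Vec n) A → ((c ⊛ x) · A) ≈ᵥ (c ⊛ (x · A))
  ·-⊛ c x A j =
    trans (Σ-cong n (λ i → *-assoc c (x i) (A i j))) (sym (*-distribˡ-Σ n c _))

  ·-assoc : ∀ (x : Vec n) A C → ((x · A) · C) ≈ᵥ (x · (A ∘ₘ C))
  ·-assoc x A C k = begin
    Σ[ n ] (λ j → Σ[ n ] (λ i → x i * A i j) * C j k)    ≡⟨ Σ-cong n (λ j → *-distribʳ-Σ n (C j k) _) ⟩
    Σ[ n ] (λ j → Σ[ n ] (λ i → x i * A i j * C j k))    ≡⟨ Σ-comm n n _ ⟨
    Σ[ n ] (λ i → Σ[ n ] (λ j → x i * A i j * C j k))    ≡⟨ Σ-cong n (λ i → Σ-cong n (λ j → *-assoc (x i) (A i j) (C j k))) ⟩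
    Σ[ n ] (λ i → Σ[ n ] (λ j → x i * (A i j * C j k)))  ≡⟨ Σ-cong n (λ i → *-distribˡ-Σ n (x i) _) ⟨
    Σ[ n ] (λ i → x i * Σ[ n ] (λ j → A i j * C j k))    ∎
    where open ≡-Reasoning

  ·-negₘ : ∀ (x : Vec n) A → (x · (-ₘ A)) ≈ᵥ (λ j → - (x · A) j)
  ·-negₘ x A j = trans (Σ-cong n (λ i → sym (ℚP.neg-distribʳ-* (x i) (A i j)))) (sym (neg-Σ n _))

  Iₘ-diag : ∀ (i : Fin n) → Iₘ i i ≡ 1ℚ
  Iₘ-diag i with i ≟ i
  ... | yes _  = refl
  ... | no i≢i = ⊥-elim (i≢i refl)

  Iₘ-offdiag : ∀ {i j : Fin n} → ¬ i ≡ j → Iₘ i j ≡ 0ℚ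
  Iₘ-offdiag {i} {j} i≢j with i ≟ j
  ... | yes i≡j = ⊥-elim (i≢j i≡j)
  ... | no _    = refl

  Iₘ-InL : ∀ (i : Fin n) → InL (Iₘ i)
  Iₘ-InL i j with i ≟ j
  ... | yes _ = ℤ.+ 1 , refl
  ... | no _  = ℤ.+ 0 , refl

  ·-identityʳ : ∀ (x : Vec n) → (x · Iₘ) ≈ᵥ x
  ·-identityʳ x j = begin
    Σ[ n ] (λ i → x i * Iₘ i j)   ≡⟨ Σ-single n _ j (λ i i≢j → trans (cong (x i *_) (Iₘ-offdiag i≢j)) (*-zeroʳ (x i))) ⟩
    x j * Iₘ j j                  ≡⟨ cong (x j *_) (Iₘ-diag j) ⟩
    x j * 1ℚ                      ≡⟨ *-identityʳ (x j) ⟩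
    x j                           ∎
    where open ≡-Reasoning

  Iₘ-row-· : ∀ (i : Fin n) A → (Iₘ i · A) ≈ᵥ A i
  Iₘ-row-· i A k = begin
    Σ[ n ] (λ m → Iₘ i m * A m k)  ≡⟨ Σ-single n _ i (λ m m≢i → trans (cong (_* A m k) (Iₘ-offdiag (m≢i ∘ sym))) (ℚP.*-zeroˡ (A m k))) ⟩
    Iₘ i i * A i k                 ≡⟨ cong (_* A i k) (Iₘ-diag i) ⟩
    1ℚ * A i k                     ≡⟨ *-identityˡ (A i k) ⟩
    A i k                          ∎
    where open ≡-Reasoning

  InL-· : ∀ {x : Vec n} {A} → InL x → IntMat A → InL (x · A)
  InL-· x∈L A-int j = IsInt-Σ n _ (λ i → IsInt-* (x∈L i) (A-int i j))

module BilinearForm {n : ℕ} (G : Mat n) where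

  B-cong : ∀ {x x' y y' : Vec n} → x ≈ᵥ x' → y ≈ᵥ y' → B G x y ≡ B G x' y'
  B-cong x≈x' y≈y' =
    Σ-cong n (λ i → Σ-cong n (λ j → cong₂ (λ a b → a * G i j * b) (x≈x' i) (y≈y' j)))

  B-congʳ : ∀ (x : Vec n) {y y'} → y ≈ᵥ y' → B G x y ≡ B G x y'
  B-congʳ x = B-cong {x = x} (λ _ → refl)

  B-+ˡ : ∀ (x y z : Vec n) → B G (x +ᵥ y) z ≡ B G x z + B G y z
  B-+ˡ x y z = trans
    (Σ-cong n (λ i → trans (Σ-cong n (λ j → distrib (x i) (y i) (G i j) (z j))) (Σ-distrib-+ n _ _)))
    (Σ-distrib-+ n _ _)
    where
    distrib : ∀ a b g c → (a + b) * g * c ≡ a * g * c + b * g * c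
    distrib = solve-∀ ℚ-ring

  B-−ᵥˡ : ∀ (x y z : Vec n) → B G (x -ᵥ y) z ≡ B G x z - B G y z
  B-−ᵥˡ x y z = trans
    (Σ-cong n (λ i → trans (Σ-cong n (λ j → distrib (x i) (y i) (G i j) (z j))) (Σ-distrib-− n _ _)))
    (Σ-distrib-− n _ _)
    where
    distrib : ∀ a b g c → (a - b) * g * c ≡ a * g * c - b * g * c
    distrib = solve-∀ ℚ-ring

  B-⊛ˡ : ∀ c (x y : Vec n) → B G (c ⊛ x) y ≡ c * B G x y
  B-⊛ˡ c x y = trans
    (Σ-cong n (λ i → trans (Σ-cong n (λ j → assoc c (x i) (G i j) (y j))) (sym (*-distribˡ-Σ n c _))))
    (sym (*-distribˡ-Σ n c _))
    where
    assoc : ∀ c a g b → c * a * g * b ≡ c * (a * g * b)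
    assoc = solve-∀ ℚ-ring

  B-negˡ : ∀ (x y : Vec n) → B G (λ i → - x i) y ≡ - B G x y
  B-negˡ x y = begin
    B G (λ i → - x i) y   ≡⟨ B-cong (λ i → sym (-1*x≈-x (x i))) (λ _ → refl) ⟩
    B G (- 1ℚ ⊛ x) y      ≡⟨ B-⊛ˡ (- 1ℚ) x y ⟩
    - 1ℚ * B G x y        ≡⟨ -1*x≈-x (B G x y) ⟩
    - B G x y             ∎
    where open ≡-Reasoning

  module Symmetric (G-sym : ∀ i j → G i j ≡ G j i) where

    B-sym : ∀ (x y : Vec n) → B G x y ≡ B G y x
    B-sym x y = trans (Σ-comm n n _)
      (Σ-cong n (λ j → Σ-cong n (λ i → trans (cong (λ g → x i * g * y j) (G-sym i j)) (swap (x i) (G j i) (y j)))))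
      where
      swap : ∀ a g b → a * g * b ≡ b * g * a
      swap = solve-∀ ℚ-ring

    B-+ʳ : ∀ (x y z : Vec n) → B G x (y +ᵥ z) ≡ B G x y + B G x z
    B-+ʳ x y z = trans (B-sym x _) (trans (B-+ˡ y z x) (cong₂ _+_ (B-sym y x) (B-sym z x)))

    B-−ᵥʳ : ∀ (x y z : Vec n) → B G x (y -ᵥ z) ≡ B G x y - B G x z
    B-−ᵥʳ x y z = trans (B-sym x _) (trans (B-−ᵥˡ y z x) (cong₂ _-_ (B-sym y x) (B-sym z x)))

    B-⊛ʳ : ∀ c (x y : Vec n) → B G x (c ⊛ y) ≡ c * B G x y
    B-⊛ʳ c x y = trans (B-sym x _) (trans (B-⊛ˡ c y x) (cong (c *_) (B-sym y x)))

B-congᴳ : ∀ {n} {G H : Mat n} → G ≈ₘ H → ∀ x y → B G x y ≡ B H x y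
B-congᴳ {n} G≈H x y = Σ-cong n (λ i → Σ-cong n (λ j → cong (λ g → x i * g * y j) (G≈H i j)))

B-· : ∀ {n} (G A : Mat n) x y → B G (x · A) (y · A) ≡ B (λ i j → B G (A i) (A j)) x y
B-· {n} G A x y = begin
  Σ[ n ] (λ k → Σ[ n ] (λ l → (x · A) k * G k l * (y · A) l))
    ≡⟨ Σ-cong n (λ k → Σ-cong n (λ l → Σ-*-Σ n n _ (G k l) _)) ⟩
  Σ[ n ] (λ k → Σ[ n ] (λ l → Σ[ n ] (λ i → Σ[ n ] (λ j → x i * A i k * G k l * (y j * A j l)))))
    ≡⟨ ΣΣ-comm n n _ ⟩
  Σ[ n ] (λ i → Σ[ n ] (λ j → Σ[ n ] (λ k → Σ[ n ] (λ l → x i * A i k * G k l * (y j * A j l)))))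
    ≡⟨ Σ-cong n (λ i → Σ-cong n (λ j → Σ-cong n (λ k → Σ-cong n (λ l → regroup (x i) (A i k) (G k l) (y j) (A j l))))) ⟩
  Σ[ n ] (λ i → Σ[ n ] (λ j → Σ[ n ] (λ k → Σ[ n ] (λ l → x i * (A i k * G k l * A j l) * y j))))
    ≡⟨ Σ-cong n (λ i → Σ-cong n (λ j → pull-out (x i) (y j) (λ k l → A i k * G k l * A j l))) ⟩
  Σ[ n ] (λ i → Σ[ n ] (λ j → x i * B G (A i) (A j) * y j))
    ∎
  where
  open ≡-Reasoning
  regroup : ∀ a b g c d → a * b * g * (c * d) ≡ a * (b * g * d) * c
  regroup = solve-∀ ℚ-ring
  pull-out : ∀ a c (h : Fin n → Fin n → ℚ) →
             Σ[ n ] (λ k → Σ[ n ] (λ l → a * h k l * c)) ≡ a * Σ[ n ] (λ k → Σ[ n ] (h k)) * c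
  pull-out a c h = trans (Σ-cong n (λ k → sym (*-Σ-* n a (h k) c))) (sym (*-Σ-* n a _ c))

-- The form (x, y) ↦ B G (x A) (y A) is determined by its values on the standard basis, which lies in L.
isometry-extends : ∀ {n} (G A : Mat n) →
  (∀ x y → InL x → InL y → B G (x · A) (y · A) ≡ B G x y) →
  ∀ x y → B G (x · A) (y · A) ≡ B G x y
isometry-extends G A isometry-on-L x y = begin
  B G (x · A) (y · A)                   ≡⟨ B-· G A x y ⟩
  B (λ i j → B G (A i) (A j)) x y       ≡⟨ B-congᴳ Gram-rows x y ⟩
  B (λ i j → B G (Iₘ i) (Iₘ j)) x y     ≡⟨ B-· G Iₘ x y ⟨
  B G (x · Iₘ) (y · Iₘ)                 ≡⟨ B-cong (·-identityʳ x) (·-identityʳ y) ⟩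
  B G x y                               ∎
  where
  open ≡-Reasoning
  open BilinearForm G
  Gram-rows : (λ i j → B G (A i) (A j)) ≈ₘ (λ i j → B G (Iₘ i) (Iₘ j))
  Gram-rows i j = trans (B-cong (sym ∘ Iₘ-row-· i A) (sym ∘ Iₘ-row-· j A))
                        (isometry-on-L (Iₘ i) (Iₘ j) (Iₘ-InL i) (Iₘ-InL j))

-- Eigenspaces of an isometric involution

⟦⟧-square : ∀ ε → ⟦ ε ⟧ * ⟦ ε ⟧ ≡ 1ℚ
⟦⟧-square Sign.+ = refl
⟦⟧-square Sign.- = refl

⟦⟧-IsInt : ∀ ε → IsInt ⟦ ε ⟧
⟦⟧-IsInt Sign.+ = ℤ.+ 1 , refl
⟦⟧-IsInt Sign.- = ℤ.-[1+ 0 ] , refl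

module Eigenspace {n : ℕ} {G t : Mat n}
  (G-sym : ∀ i j → G i j ≡ G j i)
  (t-isometry : ∀ (x y : Vec n) → B G (x · t) (y · t) ≡ B G x y)
  (t²≈I : (t ∘ₘ t) ≈ₘ Iₘ)
  (ε : Sign) where

  open BilinearForm G
  open Symmetric G-sym

  private
    s : ℚ
    s = ⟦ ε ⟧

    s*[s*q]≡q : ∀ q → s * (s * q) ≡ q
    s*[s*q]≡q q = trans (sym (*-assoc s s q)) (trans (cong (_* q) (⟦⟧-square ε)) (*-identityˡ q))

  ·t·t : ∀ (x : Vec n) → ((x · t) · t) ≈ᵥ x
  ·t·t x k = trans (·-assoc x t t k) (trans (·-congʳ x t²≈I k) (·-identityʳ x k))

  B-·t-adjoint : ∀ (x y : Vec n) → B G (x · t) y ≡ B G x (y · t)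
  B-·t-adjoint x y = trans (sym (t-isometry (x · t) y)) (B-cong (·t·t x) (λ _ → refl))

  Vε-+ᵥ : ∀ {v w : Vec n} → InVε t ε v → InVε t ε w → InVε t ε (v +ᵥ w)
  Vε-+ᵥ {v} {w} v∈V w∈V k = trans (·-distrib-+ᵥ v w t k)
    (trans (cong₂ _+_ (v∈V k) (w∈V k)) (sym (*-distribˡ-+ s (v k) (w k))))

  Vε-−ᵥ : ∀ {v w : Vec n} → InVε t ε v → InVε t ε w → InVε t ε (v -ᵥ w)
  Vε-−ᵥ {v} {w} v∈V w∈V k = trans (·-distrib-−ᵥ v w t k)
    (trans (cong₂ _-_ (v∈V k) (w∈V k)) (sym (distribˡ-− s (v k) (w k))))
    where
    distribˡ-− : ∀ c a b → c * (a - b) ≡ c * a - c * b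
    distribˡ-− = solve-∀ ℚ-ring

  -- trace b = 2 P^ε(b); unlike P^ε(b) it lies in L when b does.
  trace : Vec n → Vec n
  trace b = b +ᵥ (s ⊛ (b · t))

  trace-InL : IntMat t → ∀ {b : Vec n} → InL b → InL (trace b)
  trace-InL t-int b∈L k = IsInt-+ (b∈L k) (IsInt-* (⟦⟧-IsInt ε) (InL-· b∈L t-int k))

  trace-Vε : ∀ (b : Vec n) → InVε t ε (trace b)
  trace-Vε b k = begin
    (trace b · t) k                    ≡⟨ ·-distrib-+ᵥ b (s ⊛ (b · t)) t k ⟩
    (b · t) k + ((s ⊛ (b · t)) · t) k  ≡⟨ cong ((b · t) k +_) (trans (·-⊛ s (b · t) t k) (cong (s *_) (·t·t b k))) ⟩
    (b · t) k + s * b k                ≡⟨ cong (_+ s * b k) (s*[s*q]≡q ((b · t) k)) ⟨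
    s * (s * (b · t) k) + s * b k      ≡⟨ swap-distrib s (b k) (s * (b · t) k) ⟩
    s * (b k + s * (b · t) k)          ∎
    where
    open ≡-Reasoning
    swap-distrib : ∀ c x y → c * y + c * x ≡ c * (x + y)
    swap-distrib = solve-∀ ℚ-ring

  B-trace : ∀ {w : Vec n} → InVε t ε w → ∀ b → B G w (trace b) ≡ B G w b + B G w b
  B-trace {w} w∈V b = begin
    B G w (trace b)                  ≡⟨ B-+ʳ w b (s ⊛ (b · t)) ⟩
    B G w b + B G w (s ⊛ (b · t))    ≡⟨ cong (B G w b +_) (B-⊛ʳ s w (b · t)) ⟩
    B G w b + s * B G w (b · t)      ≡⟨ cong (λ q → B G w b + s * q) B-w-bt ⟩
    B G w b + s * (s * B G w b)      ≡⟨ cong (B G w b +_) (s*[s*q]≡q (B G w b)) ⟩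
    B G w b + B G w b                ∎
    where
    open ≡-Reasoning
    B-w-bt : B G w (b · t) ≡ s * B G w b
    B-w-bt = trans (sym (B-·t-adjoint w b)) (trans (B-cong w∈V (λ _ → refl)) (B-⊛ˡ s w b))

  B-trace-self : ∀ (b : Vec n) → B G (trace b) (trace b) ≡ B G b (trace b) + B G b (trace b)
  B-trace-self b = trans (B-trace (trace-Vε b) b) (cong (λ q → q + q) (B-sym (trace b) b))

  B-proj : ∀ (b p : Vec n) {w} → IsProjε G t ε b p → InVε t ε w → B G p w ≡ B G b w
  B-proj b p {w} (_ , b-p⊥V) w∈V =
    sym (x∙y⁻¹≈ε⇒x≈y (B G b w) (B G p w) (trans (sym (B-−ᵥˡ b p w)) (b-p⊥V w w∈V)))

  B-twice-proj : ∀ (b p b' p' : Vec n) → IsProjε G t ε b p → IsProjε G t ε b' p' →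
                 B G b p' + B G b p' ≡ B G b (trace b')
  B-twice-proj b p b' p' p=Pb p'=Pb' = begin
    B G b p' + B G b p'      ≡⟨ cong (λ q → q + q) Bbp'≡Bpb' ⟩
    B G p b' + B G p b'      ≡⟨ B-trace (proj₁ p=Pb) b' ⟨
    B G p (trace b')         ≡⟨ B-proj b p p=Pb (trace-Vε b') ⟩
    B G b (trace b')         ∎
    where
    open ≡-Reasoning
    Bbp'≡Bpb' : B G b p' ≡ B G p b'
    Bbp'≡Bpb' = begin
      B G b p'   ≡⟨ B-proj b p p=Pb (proj₁ p'=Pb') ⟨
      B G p p'   ≡⟨ B-sym p p' ⟩
      B G p' p   ≡⟨ B-proj b' p' p'=Pb' (proj₁ p=Pb) ⟩
      B G b' p   ≡⟨ B-sym b' p ⟩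
      B G p b'   ∎

-- The form on MC(L, t, f, ε) = L^ε(t) + P^ε(L)(f - 1)

module MC {n : ℕ} {G t f : Mat n}
  (G-sym : ∀ i j → G i j ≡ G j i)
  (t-isometry : ∀ (x y : Vec n) → B G (x · t) (y · t) ≡ B G x y)
  (f-isometry : ∀ (x y : Vec n) → B G (x · f) (y · f) ≡ B G x y)
  (tf≈ft : (t ∘ₘ f) ≈ₘ (f ∘ₘ t))
  (t²≈I : (t ∘ₘ t) ≈ₘ Iₘ)
  (f²≈-I : (f ∘ₘ f) ≈ₘ (-ₘ Iₘ))
  (ε : Sign) where

  open BilinearForm G
  open Symmetric G-sym
  open Eigenspace G-sym t-isometry t²≈I ε public

  _·[f+1] : Vec n → Vec n
  v ·[f+1] = (v · f) +ᵥ v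

  _·[f-1] : Vec n → Vec n
  v ·[f-1] = (v · f) -ᵥ v

  ·f·f : ∀ (x : Vec n) → ((x · f) · f) ≈ᵥ (λ i → - x i)
  ·f·f x k = trans (·-assoc x f f k)
    (trans (·-congʳ x f²≈-I k) (trans (·-negₘ x Iₘ k) (cong -_ (·-identityʳ x k))))

  B-·f-skew : ∀ (x y : Vec n) → B G (x · f) y ≡ - B G x (y · f)
  B-·f-skew x y = begin
    B G (x · f) y                  ≡⟨ f-isometry (x · f) y ⟨
    B G ((x · f) · f) (y · f)      ≡⟨ B-cong (·f·f x) (λ _ → refl) ⟩
    B G (λ i → - x i) (y · f)      ≡⟨ B-negˡ x (y · f) ⟩
    - B G x (y · f)                ∎
    where open ≡-Reasoning

  B-·[f-1]ˡ : ∀ (x y : Vec n) → B G (x ·[f-1]) y ≡ - B G x (y ·[f+1])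
  B-·[f-1]ˡ x y = begin
    B G (x ·[f-1]) y                  ≡⟨ B-−ᵥˡ (x · f) x y ⟩
    B G (x · f) y - B G x y           ≡⟨ cong (_- B G x y) (B-·f-skew x y) ⟩
    - B G x (y · f) - B G x y         ≡⟨ neg-distrib-+ (B G x (y · f)) (B G x y) ⟨
    - (B G x (y · f) + B G x y)       ≡⟨ cong -_ (B-+ʳ x (y · f) y) ⟨
    - B G x (y ·[f+1])                ∎
    where open ≡-Reasoning

  Vε-·f : ∀ {v : Vec n} → InVε t ε v → InVε t ε (v · f)
  Vε-·f {v} v∈V k = begin
    ((v · f) · t) k          ≡⟨ ·-assoc v f t k ⟩
    (v · (f ∘ₘ t)) k         ≡⟨ ·-congʳ v (λ i j → sym (tf≈ft i j)) k ⟩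
    (v · (t ∘ₘ f)) k         ≡⟨ ·-assoc v t f k ⟨
    ((v · t) · f) k          ≡⟨ ·-cong f v∈V k ⟩
    ((⟦ ε ⟧ ⊛ v) · f) k      ≡⟨ ·-⊛ ⟦ ε ⟧ v f k ⟩
    ⟦ ε ⟧ * (v · f) k        ∎
    where open ≡-Reasoning

  Vε-·[f+1] : ∀ {v : Vec n} → InVε t ε v → InVε t ε (v ·[f+1])
  Vε-·[f+1] v∈V = Vε-+ᵥ (Vε-·f v∈V) v∈V

  Vε-·[f-1] : ∀ {v : Vec n} → InVε t ε v → InVε t ε (v ·[f-1])
  Vε-·[f-1] v∈V = Vε-−ᵥ (Vε-·f v∈V) v∈V

  -- (f - 1)(f + 1) = f² - 1 = -2.
  ·[f-1]·[f+1] : ∀ (a p : Vec n) → ((a +ᵥ (p ·[f-1])) ·[f+1]) ≈ᵥ ((a ·[f+1]) -ᵥ (p +ᵥ p))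
  ·[f-1]·[f+1] a p k = begin
    ((a +ᵥ (p ·[f-1])) · f) k + (a k + ((p · f) k - p k))
      ≡⟨ cong (_+ (a k + ((p · f) k - p k))) yf≡ ⟩
    ((a · f) k + (- p k - (p · f) k)) + (a k + ((p · f) k - p k))
      ≡⟨ regroup ((a · f) k) (a k) (p k) ((p · f) k) ⟩
    ((a · f) k + a k) - (p k + p k)
      ∎
    where
    open ≡-Reasoning
    regroup : ∀ af a p pf → (af + (- p - pf)) + (a + (pf - p)) ≡ (af + a) - (p + p)
    regroup = solve-∀ ℚ-ring
    yf≡ : ((a +ᵥ (p ·[f-1])) · f) k ≡ (a · f) k + (- p k - (p · f) k)
    yf≡ = trans (·-distrib-+ᵥ a (p ·[f-1]) f k)
      (cong ((a · f) k +_) (trans (·-distrib-−ᵥ (p · f) p f k) (cong (_- (p · f) k) (·f·f p k))))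

  B-mcˡ : ∀ a b p {y : Vec n} → IsProjε G t ε b p → InVε t ε y →
          B G (a +ᵥ (p ·[f-1])) y ≡ B G a y - B G b (y ·[f+1])
  B-mcˡ a b p {y} p=Pb y∈V = begin
    B G (a +ᵥ (p ·[f-1])) y             ≡⟨ B-+ˡ a (p ·[f-1]) y ⟩
    B G a y + B G (p ·[f-1]) y          ≡⟨ cong (B G a y +_) (B-·[f-1]ˡ p y) ⟩
    B G a y - B G p (y ·[f+1])          ≡⟨ cong (_-_ (B G a y)) (B-proj b p p=Pb (Vε-·[f+1] y∈V)) ⟩
    B G a y - B G b (y ·[f+1])          ∎
    where open ≡-Reasoning

  B-mc : ∀ {a a' : Vec n} b p b' p' → InVε t ε a → InVε t ε a' →
         IsProjε G t ε b p → IsProjε G t ε b' p' →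
         B G (a +ᵥ (p ·[f-1])) (a' +ᵥ (p' ·[f-1])) ≡
           (B G a' a - B G b' (a ·[f+1])) - (B G b (a' ·[f+1]) - B G b (trace b'))
  B-mc {a} {a'} b p b' p' a∈V a'∈V p=Pb p'=Pb' = begin
    B G (a +ᵥ (p ·[f-1])) y
      ≡⟨ B-mcˡ a b p p=Pb y∈V ⟩
    B G a y - B G b (y ·[f+1])
      ≡⟨ cong₂ _-_ (trans (B-sym a y) (B-mcˡ a' b' p' p'=Pb' a∈V)) (B-congʳ b (·[f-1]·[f+1] a' p')) ⟩
    (B G a' a - B G b' (a ·[f+1])) - B G b ((a' ·[f+1]) -ᵥ (p' +ᵥ p'))
      ≡⟨ cong (_-_ (B G a' a - B G b' (a ·[f+1]))) (trans (B-−ᵥʳ b _ _) (cong (_-_ (B G b (a' ·[f+1]))) b-2p')) ⟩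
    (B G a' a - B G b' (a ·[f+1])) - (B G b (a' ·[f+1]) - B G b (trace b'))
      ∎
    where
    open ≡-Reasoning
    y = a' +ᵥ (p' ·[f-1])
    y∈V : InVε t ε y
    y∈V = Vε-+ᵥ a'∈V (Vε-·[f-1] (proj₁ p'=Pb'))
    b-2p' : B G b (p' +ᵥ p') ≡ B G b (trace b')
    b-2p' = trans (B-+ʳ b p' p') (B-twice-proj b p b' p' p=Pb p'=Pb')

lemma3p2 : (n : ℕ) (G t f : Mat n) →
    IsLattice G → IsIntegral G →
    InO G t → InO G f →
    (t ∘ₘ f) ≈ₘ (f ∘ₘ t) →
    (t ∘ₘ t) ≈ₘ Iₘ →
    (f ∘ₘ f) ≈ₘ (-ₘ Iₘ) →
    (ε : Sign) →
    (∀ (x y : Vec n) → InMC G t f ε x → InMC G t f ε y → IsInt (B G x y)) ×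
    ((∀ (a : Vec n) → InLε t ε a → DoublyEvenQ (B G a a)) →
      ∀ (x : Vec n) → InMC G t f ε x → EvenQ (B G x x))
lemma3p2 n G t f (G-sym , _) G-integral (t-int , _ , t-on-L) (f-int , _ , f-on-L) tf≈ft t²≈I f²≈-I ε =
  integral , even
  where
  open BilinearForm G
  open MC G-sym (isometry-extends G t t-on-L) (isometry-extends G f f-on-L) tf≈ft t²≈I f²≈-I ε

  ·[f+1]-InL : ∀ {a : Vec n} → InL a → InL (a ·[f+1])
  ·[f+1]-InL a∈L k = IsInt-+ (InL-· a∈L f-int k) (a∈L k)

  integral : ∀ (x y : Vec n) → InMC G t f ε x → InMC G t f ε y → IsInt (B G x y)
  integral x y (a , b , p , (a∈L , a∈V) , b∈L , p=Pb , x≈) (a' , b' , p' , (a'∈L , a'∈V) , b'∈L , p'=Pb' , y≈) =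
    subst IsInt (sym (trans (B-cong x≈ y≈) (B-mc b p b' p' a∈V a'∈V p=Pb p'=Pb')))
      (IsInt-+ (IsInt-+ (G-integral a' a a'∈L a∈L) (IsInt-neg (G-integral b' _ b'∈L (·[f+1]-InL a∈L))))
               (IsInt-neg (IsInt-+ (G-integral b _ b∈L (·[f+1]-InL a'∈L))
                                   (IsInt-neg (G-integral b _ b∈L (trace-InL t-int b'∈L))))))

  even : (∀ (a : Vec n) → InLε t ε a → DoublyEvenQ (B G a a)) →
         ∀ (x : Vec n) → InMC G t f ε x → EvenQ (B G x x)
  even doubly-even x (a , b , p , (a∈L , a∈V) , b∈L , p=Pb , x≈) =
    subst EvenQ (sym (trans (B-cong x≈ x≈) (trans (B-mc b p b p a∈V a∈V p=Pb p=Pb) (rearrange (B G a a) (B G b (a ·[f+1])) (B G b (trace b))))))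
      (EvenQ-+ (EvenQ-+ (DoublyEvenQ⇒EvenQ (doubly-even a (a∈L , a∈V))) b·trace-even)
               (EvenQ-neg (EvenQ-double (G-integral b _ b∈L (·[f+1]-InL a∈L)))))
    where
    rearrange : ∀ A u T → (A - u) - (u - T) ≡ (A + T) - (u + u)
    rearrange = solve-∀ ℚ-ring
    b·trace-even : EvenQ (B G b (trace b))
    b·trace-even = EvenQ-halve (subst DoublyEvenQ (B-trace-self b)
      (doubly-even (trace b) (trace-InL t-int b∈L , trace-Vε b)))
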